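{- Let $a,c,t$ be integers with $a,t\geq 2$ and $a>c\geq 1$, and suppose $(a-1)(c-1)<t-1$. Then the graph $G_{a,c,t}$ (constructed as in the context) is an extremal $(a(t-1)\,|\,t+c-1)$-graph: it is $a(t-1)$-regular with chromatic number $t+c-1$, and every $a(t-1)$-regular graph with chromatic number $t+c-1$ has at least $at$ vertices.
   Context: An $(r|\chi)$-graph is a simple finite $r$-regular graph with chromatic number $\chi$; it is extremal if it has minimum order among all $(r|\chi)$-graphs. Construction of $G_{a,c,t}$: start from the complete $t$-partite graph with parts $V_1,\dots,V_t$, each of size $a$. Choose $c$ vertices $u_1,\dots,u_c\in V_1$ and $c$ vertices $v_1,\dots,v_c\in V_2$. Remove all edges $u_iv_j$ with $i\neq j$ ($i,j\in\{1,\dots,c\}$), keeping the matching $u_iv_i$, and add all edges $u_iu_j$ and $v_iv_j$ with $i\neq j$ ($i,j\in\{1,\dots,c\}$). -}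

module Defs where

open import Data.Nat using (ℕ; zero; suc; _+_; _*_; _∸_; _≤_; _<_; _≟_; _<?_)
open import Data.Bool using (Bool; true; false; if_then_else_; _∧_; not)
open import Data.Fin using (Fin; toℕ; remQuot)
open import Data.List using (List; map; allFin)
open import Data.Nat.ListAction using (sum)
open import Data.Product using (_×_; _,_; proj₁; proj₂)
open import Relation.Nullary using (¬_)
open import Relation.Nullary.Decidable using (⌊_⌋)
open import Relation.Binary.PropositionalEquality using (_≡_; _≢_)

Adj : ℕ → Set
Adj n = Fin n → Fin n → Bool

IsSimple : ∀ {n} → Adj n → Set
IsSimple {n} G = (∀ (i j : Fin n) → G i j ≡ G j i) × (∀ (i : Fin n) → G i i ≡ false)

degree : ∀ {n} → Adj n → Fin n → ℕ
degree {n} G i = sum (map (λ j → if G i j then 1 else 0) (allFin n))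

IsRegular : ∀ {n} → Adj n → ℕ → Set
IsRegular {n} G r = ∀ (i : Fin n) → degree G i ≡ r

Colorable : ∀ {n} → Adj n → ℕ → Set
Colorable {n} G k =
  Data.Product.Σ (Fin n → Fin k) λ f → ∀ (i j : Fin n) → G i j ≡ true → f i ≢ f j

HasChromaticNumber : ∀ {n} → Adj n → ℕ → Set
HasChromaticNumber G χ = Colorable G χ × (∀ k → Colorable G k → χ ≤ k)

IsRChiGraph : ∀ {n} → Adj n → ℕ → ℕ → Set
IsRChiGraph G r χ = IsSimple G × IsRegular G r × HasChromaticNumber G χ

IsExtremal : ∀ {n} → Adj n → ℕ → ℕ → Set
IsExtremal {n} G r χ =
  IsRChiGraph G r χ × (∀ (m : ℕ) (H : Adj m) → IsRChiGraph H r χ → n ≤ m)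

-- Vertex x ∈ Fin (t * a) corresponds to the pair (p , q) = remQuot a x:
-- x lies in part V_{p+1} (p : Fin t) at position q (q : Fin a).
-- u_{i+1} = (0 , i), v_{i+1} = (1 , i) for i < c.
Gact : (a c t : ℕ) → Adj (t * a)
Gact a c t x y =
  let P  = toℕ (proj₁ (remQuot {t} a x))
      Q  = toℕ (proj₂ (remQuot {t} a x))
      P' = toℕ (proj₁ (remQuot {t} a y))
      Q' = toℕ (proj₂ (remQuot {t} a y))
      special = ⌊ Q <? c ⌋ ∧ ⌊ Q' <? c ⌋ ∧ not ⌊ Q ≟ Q' ⌋
  in if ⌊ P ≟ P' ⌋
       -- same part: adjacent iff both are u's (or both v's) and distinct (added cliques)
       then ⌊ P <? 2 ⌋ ∧ special
       -- different parts: complete multipartite, except removed edges u_i v_j (i ≠ j)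
       else not (⌊ P <? 2 ⌋ ∧ ⌊ P' <? 2 ⌋ ∧ special)

module Submission where

-- Regularity: at each position q the vertices (0,q), (1,q) together contribute
-- as many neighbours of a fixed vertex as in the complete t-partite graph, and on the parts
-- p ≥ 2 the two graphs agree, so every degree is a(t-1).  χ ≤ t+c-1 by an explicit colouring;
-- χ ≥ t+c-1 since u_1,…,u_c and the vertex at position c of each part 1,…,t-1 form a clique.
-- Minimal order: in an r-regular graph on m vertices a colour class lies in the
-- non-neighbourhood of any of its members, of size m-r, so m ≤ χ(m-r); for r = a(t-1),
-- χ = t+c-1 and (a-1)(c-1) < t-1 this forces m ≥ at.

open import Defs
open import Data.Nat using (ℕ; zero; suc; _+_; _*_; _∸_; _≤_; _<_; _≟_; _<?_; _≤?_; z≤n; s≤s)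
open import Data.Nat.Properties
  using ( +-0-commutativeMonoid; +-assoc; +-comm; *-comm; *-identityʳ; +-cancelˡ-≡; +-cancelʳ-≤
        ; +-mono-≤; +-monoʳ-≤; *-monoʳ-≤; ≤-refl; ≤-reflexive; ≤-trans; ≤-pred; <⇒≤; <⇒≱; ≰⇒>; ≤⇒≯
        ; m<m+n; m≤n+m; suc-injective; <-irrefl; module ≤-Reasoning )
open import Data.Nat.Tactic.RingSolver using (solve-∀)
open import Data.Nat.ListAction using () renaming (sum to listSum)
open import Algebra.Properties.CommutativeMonoid.Sum +-0-commutativeMonoid
  using (sum-syntax; sum-cong-≗; sum-replicate-zero; ∑-distrib-+; ∑-comm)
open import Data.Bool using (Bool; true; false; if_then_else_; _∧_; not)
open import Data.Bool.Properties using (∧-zeroʳ)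
open import Data.Fin using (Fin; toℕ; remQuot; combine; splitAt; join; inject≤; fromℕ<; _↑ˡ_; _↑ʳ_)
  renaming (zero to fzero; suc to fsuc)
open import Data.Fin.Properties
  using (toℕ<n; toℕ-injective; toℕ-fromℕ<; toℕ-inject≤; remQuot-combine; join-splitAt; injective⇒≤; any?)
  renaming (_≟_ to _≟ᶠ_)
import Data.List as List
import Data.List.Properties as List
open import Data.Product using (_,_; proj₁; proj₂)
open import Data.Sum using (_⊎_; inj₁; inj₂)
open import Function using (_∘_; _⇔_; mk⇔)
open import Relation.Nullary using (¬_; Dec; yes; no; contradiction)
open import Relation.Nullary.Decidable using (⌊_⌋; isYes≗does; does-⇔)
open import Relation.Binary.PropositionalEquality
  using (_≡_; _≢_; refl; sym; trans; cong; cong₂; subst; module ≡-Reasoning)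

⌊⌋-yes : ∀ {A : Set} (d : Dec A) → A → ⌊ d ⌋ ≡ true
⌊⌋-yes (yes _) _  = refl
⌊⌋-yes (no ¬a) a  = contradiction a ¬a

⌊⌋-no : ∀ {A : Set} (d : Dec A) → ¬ A → ⌊ d ⌋ ≡ false
⌊⌋-no (no _)  _  = refl
⌊⌋-no (yes a) ¬a = contradiction a ¬a

⌊⌋-⇔ : ∀ {A B : Set} → A ⇔ B → (d : Dec A) (e : Dec B) → ⌊ d ⌋ ≡ ⌊ e ⌋
⌊⌋-⇔ A⇔B d e = trans (isYes≗does d) (trans (does-⇔ A⇔B d e) (sym (isYes≗does e)))

≟-sym : ∀ m n → ⌊ m ≟ n ⌋ ≡ ⌊ n ≟ m ⌋
≟-sym m n = ⌊⌋-⇔ (mk⇔ sym sym) (m ≟ n) (n ≟ m)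

≟-suc : ∀ m n → ⌊ suc m ≟ suc n ⌋ ≡ ⌊ m ≟ n ⌋
≟-suc m n = ⌊⌋-⇔ (mk⇔ suc-injective (cong suc)) (suc m ≟ suc n) (m ≟ n)

∧-exchange : ∀ x y z → x ∧ (y ∧ z) ≡ y ∧ (x ∧ z)
∧-exchange true  y     z = refl
∧-exchange false true  z = refl
∧-exchange false false z = refl

ind : Bool → ℕ
ind b = if b then 1 else 0

ind-not : ∀ b → ind b + ind (not b) ≡ 1
ind-not true  = refl
ind-not false = refl

listSum-tabulate : ∀ n (g : Fin n → ℕ) → listSum (List.tabulate g) ≡ ∑[ i < n ] g i
listSum-tabulate zero    g = refl
listSum-tabulate (suc n) g = cong (g fzero +_) (listSum-tabulate n (g ∘ fsuc))

∑-const : ∀ n k → ∑[ i < n ] k ≡ n * k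
∑-const zero    k = refl
∑-const (suc n) k = cong (k +_) (∑-const n k)

∑-mono : ∀ {n} {f g : Fin n → ℕ} → (∀ i → f i ≤ g i) → ∑[ i < n ] f i ≤ ∑[ i < n ] g i
∑-mono {zero}  f≤g = z≤n
∑-mono {suc n} f≤g = +-mono-≤ (f≤g fzero) (∑-mono (f≤g ∘ fsuc))

∑-ind+∑-ind-not : ∀ {n} (b : Fin n → Bool) →
  ∑[ i < n ] ind (b i) + ∑[ i < n ] ind (not (b i)) ≡ n
∑-ind+∑-ind-not {n} b = begin
  ∑[ i < n ] ind (b i) + ∑[ i < n ] ind (not (b i))  ≡⟨ ∑-distrib-+ {n} _ _ ⟨
  ∑[ i < n ] (ind (b i) + ind (not (b i)))            ≡⟨ sum-cong-≗ {n} (ind-not ∘ b) ⟩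
  ∑[ i < n ] 1                                        ≡⟨ ∑-const n 1 ⟩
  n * 1                                               ≡⟨ *-identityʳ n ⟩
  n                                                   ∎
  where open ≡-Reasoning

∑-↑ : ∀ m n (g : Fin (m + n) → ℕ) →
  ∑[ i < m + n ] g i ≡ ∑[ i < m ] g (i ↑ˡ n) + ∑[ j < n ] g (m ↑ʳ j)
∑-↑ zero    n g = refl
∑-↑ (suc m) n g = trans (cong (g fzero +_) (∑-↑ m n (g ∘ fsuc))) (sym (+-assoc (g fzero) _ _))

∑-combine : ∀ m n (g : Fin (m * n) → ℕ) →
  ∑[ i < m * n ] g i ≡ ∑[ p < m ] ∑[ q < n ] g (combine p q)
∑-combine zero    n g = refl
∑-combine (suc m) n g =
  trans (∑-↑ n (m * n) g) (cong (∑[ q < n ] g (q ↑ˡ (m * n)) +_) (∑-combine m n (g ∘ (n ↑ʳ_))))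

∑-indicator : ∀ {n} P → P < n → ∑[ p < n ] ind ⌊ P ≟ toℕ p ⌋ ≡ 1
∑-indicator {suc n} zero    _          = cong suc (sum-replicate-zero n)
∑-indicator {suc n} (suc P) (s≤s P<n) =
  trans (sum-cong-≗ {n} (λ p → cong ind (≟-suc P (toℕ p)))) (∑-indicator P P<n)

∑-indicator-not : ∀ {n} P → P < suc n → ∑[ p < suc n ] ind (not ⌊ P ≟ toℕ p ⌋) ≡ n
∑-indicator-not {n} P P<n = suc-injective
  (trans (cong (_+ ∑[ p < suc n ] ind (not ⌊ P ≟ toℕ p ⌋)) (sym (∑-indicator P P<n))) (∑-ind+∑-ind-not (λ p → ⌊ P ≟ toℕ p ⌋)))

degree≡∑ : ∀ {n} (G : Adj n) i → degree G i ≡ ∑[ j < n ] ind (G i j)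
degree≡∑ {n} G i =
  trans (cong listSum (List.map-tabulate (λ j → j) (λ j → ind (G i j)))) (listSum-tabulate n _)

-- The number of non-neighbours of a vertex (the vertex itself included).
coDegree : ∀ {n} → Adj n → Fin n → ℕ
coDegree {n} G i = ∑[ j < n ] ind (not (G i j))

degree+coDegree : ∀ {n} (G : Adj n) i → degree G i + coDegree G i ≡ n
degree+coDegree G i = trans (cong (_+ coDegree G i) (degree≡∑ G i)) (∑-ind+∑-ind-not (G i))

regular⇒coDegree-const : ∀ {n r} (G : Adj n) → IsRegular G r → ∀ i j → coDegree G i ≡ coDegree G j
regular⇒coDegree-const {n} {r} G regular i j = +-cancelˡ-≡ r _ _ (begin
  r + coDegree G i           ≡⟨ cong (_+ coDegree G i) (regular i) ⟨
  degree G i + coDegree G i  ≡⟨ degree+coDegree G i ⟩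
  n                          ≡⟨ degree+coDegree G j ⟨
  degree G j + coDegree G j  ≡⟨ cong (_+ coDegree G j) (regular j) ⟩
  r + coDegree G j           ∎)
  where open ≡-Reasoning

clique-bound : ∀ {n m k} (G : Adj n) (v : Fin m → Fin n) →
  (∀ x y → x ≢ y → G (v x) (v y) ≡ true) → Colorable G k → m ≤ k
clique-bound G v clique (f , proper) = injective⇒≤ injective
  where
  injective : ∀ {x y} → f (v x) ≡ f (v y) → x ≡ y
  injective {x} {y} same with x ≟ᶠ y
  ... | yes x≡y = x≡y
  ... | no  x≢y = contradiction same (proper (v x) (v y) (clique x y x≢y))

module ColourClasses {n K} (G : Adj n) (f : Fin n → Fin K)
                     (proper : ∀ i j → G i j ≡ true → f i ≢ f j) where

  classSize : Fin K → ℕ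
  classSize k = ∑[ j < n ] ind ⌊ toℕ (f j) ≟ toℕ k ⌋

  -- A colour class avoids the neighbourhood of each of its members.
  classSize≤coDegree : ∀ i → classSize (f i) ≤ coDegree G i
  classSize≤coDegree i = ∑-mono member⇒non-neighbour
    where
    member⇒non-neighbour : ∀ j → ind ⌊ toℕ (f j) ≟ toℕ (f i) ⌋ ≤ ind (not (G i j))
    member⇒non-neighbour j with toℕ (f j) ≟ toℕ (f i) | G i j in adj
    ... | no _     | _     = z≤n
    ... | yes _    | false = ≤-refl
    ... | yes same | true  = contradiction (toℕ-injective (sym same)) (proper i j adj)

  order≤colours*bound : ∀ s → (∀ k → classSize k ≤ s) → n ≤ K * s
  order≤colours*bound s bound = begin
    n                                              ≡⟨ trans (∑-const n 1) (*-identityʳ n) ⟨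
    ∑[ j < n ] 1                                   ≡⟨ sum-cong-≗ {n} (λ j → ∑-indicator (toℕ (f j)) (toℕ<n (f j))) ⟨
    ∑[ j < n ] ∑[ k < K ] ind ⌊ toℕ (f j) ≟ toℕ k ⌋ ≡⟨ ∑-comm {n} {K} (λ j k → ind ⌊ toℕ (f j) ≟ toℕ k ⌋) ⟩
    ∑[ k < K ] classSize k                         ≤⟨ ∑-mono bound ⟩
    ∑[ k < K ] s                                   ≡⟨ ∑-const K s ⟩
    K * s                                          ∎
    where open ≤-Reasoning

regular-colouring-bound : ∀ {n r K} (G : Adj n) → IsRegular G r → Colorable G K →
  (i : Fin n) → n ≤ K * coDegree G i
regular-colouring-bound {n} G regular (f , proper) i = order≤colours*bound (coDegree G i) classBound
  where
  open ColourClasses G f proper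
  classBound : ∀ k → classSize k ≤ coDegree G i
  classBound k with any? (λ j → toℕ (f j) ≟ toℕ k)
  ... | yes (j , fj≡k) = subst (λ k → classSize k ≤ coDegree G i) (toℕ-injective fj≡k)
    (≤-trans (classSize≤coDegree j) (≤-reflexive (regular⇒coDegree-const G regular j i)))
  ... | no empty = ≤-trans (≤-trans (∑-mono absent) (≤-reflexive (sum-replicate-zero n))) z≤n
    where
    absent : ∀ j → ind ⌊ toℕ (f j) ≟ toℕ k ⌋ ≤ 0
    absent j = ≤-reflexive (cong ind (⌊⌋-no (toℕ (f j) ≟ toℕ k) (λ same → empty (j , same))))

few-non-neighbours : ∀ a' c' T s → s ≤ a' → suc a' * T + s ≤ (T + suc c') * s → T ≤ a' * c'
few-non-neighbours a' c' T s s≤a' bound = +-cancelʳ-≤ (T * a') T (a' * c') (begin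
  T + T * a'        ≡⟨ split a' T ⟩
  suc a' * T        ≤⟨ +-cancelʳ-≤ s (suc a' * T) (T * s + c' * s) (≤-trans bound (≤-reflexive (expand T c' s))) ⟩
  T * s + c' * s    ≤⟨ +-mono-≤ (*-monoʳ-≤ T s≤a') (*-monoʳ-≤ c' s≤a') ⟩
  T * a' + c' * a'  ≡⟨ reorder a' c' T ⟩
  a' * c' + T * a'  ∎)
  where
  open ≤-Reasoning
  split : ∀ a T → T + T * a ≡ suc a * T
  split = solve-∀
  expand : ∀ T c s → (T + suc c) * s ≡ T * s + c * s + s
  expand = solve-∀
  reorder : ∀ a c T → T * a + c * a ≡ a * c + T * a
  reorder = solve-∀

order-arith : ∀ a' c' T s n → a' * c' < T → n ≡ suc a' * T + s → n ≤ (T + suc c') * s → suc T * suc a' ≤ n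
order-arith a' c' T s n small order bound with suc a' ≤? s
... | yes a≤s = begin
  suc a' + T * suc a'  ≡⟨ +-comm (suc a') (T * suc a') ⟩
  T * suc a' + suc a'  ≡⟨ cong (_+ suc a') (*-comm T (suc a')) ⟩
  suc a' * T + suc a'  ≤⟨ +-monoʳ-≤ (suc a' * T) a≤s ⟩
  suc a' * T + s       ≡⟨ order ⟨
  n                    ∎
  where open ≤-Reasoning
... | no a≰s = contradiction
  (few-non-neighbours a' c' T s (≤-pred (≰⇒> a≰s)) (subst (_≤ (T + suc c') * s) order bound)) (<⇒≱ small)

order-bound : ∀ a' c' T → a' * c' < T →
  ∀ m (H : Adj m) → IsRChiGraph H (suc a' * T) (T + suc c') → suc T * suc a' ≤ m
-- (the empty graph is 0-colourable, so its chromatic number cannot be T + c)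
order-bound a' c' T small zero H (_ , _ , _ , minimal) =
  contradiction (≤-trans (m≤n+m (suc c') T) (minimal 0 ((λ ()) , (λ ())))) λ ()
order-bound a' c' T small (suc m) H (_ , regular , colouring , _) =
  order-arith a' c' T (coDegree H fzero) (suc m) small order (regular-colouring-bound H regular colouring fzero)
  where
  order : suc m ≡ suc a' * T + coDegree H fzero
  order = trans (sym (degree+coDegree H fzero)) (cong (_+ coDegree H fzero) (regular fzero))

special : ℕ → ℕ → ℕ → Bool
special c q q' = ⌊ q <? c ⌋ ∧ ⌊ q' <? c ⌋ ∧ not ⌊ q ≟ q' ⌋

adjacent : ℕ → ℕ → ℕ → ℕ → ℕ → Bool
adjacent c p q p' q' =
  if ⌊ p ≟ p' ⌋ then ⌊ p <? 2 ⌋ ∧ special c q q'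
  else not (⌊ p <? 2 ⌋ ∧ ⌊ p' <? 2 ⌋ ∧ special c q q')

part position : ∀ a t → Fin (t * a) → ℕ
part     a t x = toℕ (proj₁ (remQuot {t} a x))
position a t x = toℕ (proj₂ (remQuot {t} a x))

Gact-combineʳ : ∀ a c t x (p : Fin t) (q : Fin a) →
  Gact a c t x (combine p q) ≡ adjacent c (part a t x) (position a t x) (toℕ p) (toℕ q)
Gact-combineʳ a c t x p q =
  cong (λ y → adjacent c (part a t x) (position a t x) (toℕ (proj₁ y)) (toℕ (proj₂ y))) (remQuot-combine p q)

Gact-combine : ∀ a c t (p p' : Fin t) (q q' : Fin a) →
  Gact a c t (combine p q) (combine p' q') ≡ adjacent c (toℕ p) (toℕ q) (toℕ p') (toℕ q')
Gact-combine a c t p p' q q' = trans (Gact-combineʳ a c t (combine p q) p' q')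
  (cong (λ x → adjacent c (toℕ (proj₁ x)) (toℕ (proj₂ x)) (toℕ p') (toℕ q')) (remQuot-combine p q))

special-sym : ∀ c q q' → special c q q' ≡ special c q' q
special-sym c q q' = trans (∧-exchange ⌊ q <? c ⌋ ⌊ q' <? c ⌋ _)
  (cong (λ b → ⌊ q' <? c ⌋ ∧ (⌊ q <? c ⌋ ∧ not b)) (≟-sym q q'))

adjacent-sym : ∀ c p q p' q' → adjacent c p q p' q' ≡ adjacent c p' q' p q
adjacent-sym c p q p' q' rewrite ≟-sym p' p | special-sym c q' q with p ≟ p'
... | yes refl = refl
... | no _     = cong not (∧-exchange ⌊ p <? 2 ⌋ ⌊ p' <? 2 ⌋ (special c q q'))

special-irrefl : ∀ c q → special c q q ≡ false
special-irrefl c q rewrite ⌊⌋-yes (q ≟ q) refl =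
  trans (cong (⌊ q <? c ⌋ ∧_) (∧-zeroʳ ⌊ q <? c ⌋)) (∧-zeroʳ ⌊ q <? c ⌋)

adjacent-irrefl : ∀ c p q → adjacent c p q p q ≡ false
adjacent-irrefl c p q rewrite ⌊⌋-yes (p ≟ p) refl | special-irrefl c q = ∧-zeroʳ ⌊ p <? 2 ⌋

Gact-simple : ∀ a c t → IsSimple (Gact a c t)
Gact-simple a c t =
  (λ x y → adjacent-sym c (part a t x) (position a t x) (part a t y) (position a t y)) ,
  (λ x → adjacent-irrefl c (part a t x) (position a t x))

-- At a fixed position, the parts 0 and 1 together hold as many neighbours of (P, Q) as in
-- the complete multipartite graph: the special pairs are moved from one part to the other.
adjacent-parts01 : ∀ c P Q q →
  ind (adjacent c P Q 0 q) + ind (adjacent c P Q 1 q) ≡ ind (not ⌊ P ≟ 0 ⌋) + ind (not ⌊ P ≟ 1 ⌋)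
adjacent-parts01 c zero          Q q = ind-not (special c Q q)
adjacent-parts01 c (suc zero)    Q q = trans (+-comm (ind (not (special c Q q))) _) (ind-not (special c Q q))
adjacent-parts01 c (suc (suc P)) Q q = refl

adjacent-high : ∀ c P Q p q → adjacent c P Q (suc (suc p)) q ≡ not ⌊ P ≟ suc (suc p) ⌋
adjacent-high c zero          Q p q = refl
adjacent-high c (suc zero)    Q p q = refl
adjacent-high c (suc (suc P)) Q p q with ⌊ suc (suc P) ≟ suc (suc p) ⌋
... | true  = refl
... | false = refl

column-count : ∀ c t P Q q →
  ∑[ p < suc (suc t) ] ind (adjacent c P Q (toℕ p) q) ≡ ∑[ p < suc (suc t) ] ind (not ⌊ P ≟ toℕ p ⌋)
column-count c t P Q q = begin
  g 0 + (g 1 + ∑[ p < t ] g (suc (suc (toℕ p))))  ≡⟨ +-assoc (g 0) (g 1) _ ⟨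
  g 0 + g 1 + ∑[ p < t ] g (suc (suc (toℕ p)))    ≡⟨ cong₂ _+_ (adjacent-parts01 c P Q q)
                                                         (sum-cong-≗ {t} (λ p → cong ind (adjacent-high c P Q (toℕ p) q))) ⟩
  k 0 + k 1 + ∑[ p < t ] k (suc (suc (toℕ p)))    ≡⟨ +-assoc (k 0) (k 1) _ ⟩
  k 0 + (k 1 + ∑[ p < t ] k (suc (suc (toℕ p))))  ∎
  where
  open ≡-Reasoning
  g k : ℕ → ℕ
  g p = ind (adjacent c P Q p q)
  k p = ind (not ⌊ P ≟ p ⌋)

Gact-regular : ∀ a c t → IsRegular (Gact a c (suc (suc t))) (a * suc t)
Gact-regular a c t x = begin
  degree (Gact a c t₂) x                                 ≡⟨ degree≡∑ (Gact a c t₂) x ⟩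
  ∑[ y < t₂ * a ] ind (Gact a c t₂ x y)                  ≡⟨ ∑-combine t₂ a _ ⟩
  ∑[ p < t₂ ] ∑[ q < a ] ind (Gact a c t₂ x (combine p q))
    ≡⟨ sum-cong-≗ {t₂} (λ p → sum-cong-≗ {a} (λ q → cong ind (Gact-combineʳ a c t₂ x p q))) ⟩
  ∑[ p < t₂ ] ∑[ q < a ] ind (adjacent c P Q (toℕ p) (toℕ q))
    ≡⟨ ∑-comm {t₂} {a} (λ p q → ind (adjacent c P Q (toℕ p) (toℕ q))) ⟩
  ∑[ q < a ] ∑[ p < t₂ ] ind (adjacent c P Q (toℕ p) (toℕ q))
    ≡⟨ sum-cong-≗ {a} (λ q → column-count c t P Q (toℕ q)) ⟩
  ∑[ q < a ] ∑[ p < t₂ ] ind (not ⌊ P ≟ toℕ p ⌋)         ≡⟨ ∑-const a _ ⟩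
  a * ∑[ p < t₂ ] ind (not ⌊ P ≟ toℕ p ⌋)                ≡⟨ cong (a *_) (∑-indicator-not P (toℕ<n (proj₁ (remQuot {t₂} a x)))) ⟩
  a * suc t                                             ∎
  where
  open ≡-Reasoning
  t₂ = suc (suc t)
  P = part a t₂ x
  Q = position a t₂ x

colour : ℕ → ℕ → ℕ → ℕ
colour c zero          q = if ⌊ q <? c ⌋ then q else 0
colour c (suc zero)    q = if ⌊ q <? c ⌋ then suc q else c
colour c (suc (suc p)) q = c + suc p

colour-low : ∀ c p q → p < 2 → colour c p q ≤ c
colour-low c zero q _ with q <? c
... | yes q<c = <⇒≤ q<c
... | no _    = z≤n
colour-low c (suc zero) q _ with q <? c
... | yes q<c = q<c
... | no _    = ≤-refl
colour-low c (suc (suc p)) q (s≤s (s≤s ()))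

low≢high : ∀ c p x → x ≤ c → x ≢ c + suc p
low≢high c p x x≤c x≡ = <-irrefl x≡ (≤-trans (s≤s x≤c) (m<m+n c (s≤s z≤n)))

colour-bound : ∀ c t p q → p < suc (suc t) → colour c p q < suc t + c
colour-bound c t zero          q _ = s≤s (≤-trans (colour-low c 0 q (s≤s z≤n)) (m≤n+m c t))
colour-bound c t (suc zero)    q _ = s≤s (≤-trans (colour-low c 1 q (s≤s (s≤s z≤n))) (m≤n+m c t))
colour-bound c t (suc (suc p)) q (s≤s (s≤s p<t)) = s≤s (≤-trans (+-monoʳ-≤ c p<t) (≤-reflexive (+-comm c t)))

colour-proper : ∀ c p q p' q' → 1 ≤ c → adjacent c p q p' q' ≡ true → colour c p q ≢ colour c p' q'
colour-proper c zero q zero q' _ adj same with q <? c | q' <? c | q ≟ q'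
... | yes _ | yes _ | no q≢q' = q≢q' same
... | yes _ | yes _ | yes _   = contradiction adj λ ()
... | yes _ | no _  | _       = contradiction adj λ ()
... | no _  | _     | _       = contradiction adj λ ()
colour-proper c (suc zero) q (suc zero) q' _ adj same with q <? c | q' <? c | q ≟ q'
... | yes _ | yes _ | no q≢q' = q≢q' (suc-injective same)
... | yes _ | yes _ | yes _   = contradiction adj λ ()
... | yes _ | no _  | _       = contradiction adj λ ()
... | no _  | _     | _       = contradiction adj λ ()
-- between parts 0 and 1 the colours only meet at u_{i+1}, v_i, which are not adjacent
-- (c ≥ 1 separates the colour 0 of part 0 from the colour c of part 1)
colour-proper c zero q (suc zero) q' c≥1 adj same with q <? c | q' <? c | q ≟ q'
... | yes _   | yes _ | yes q≡q' = contradiction (trans (sym q≡q') same) (λ ())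
... | yes _   | yes _ | no _     = contradiction adj λ ()
... | yes q<c | no _  | _        = <-irrefl same q<c
... | no _    | yes _ | _        = contradiction same λ ()
... | no _    | no _  | _        = <-irrefl same c≥1
colour-proper c (suc zero) q zero q' c≥1 adj same =
  colour-proper c zero q' (suc zero) q c≥1 (trans (adjacent-sym c 0 q' 1 q) adj) (sym same)
colour-proper c zero q (suc (suc p)) q' _ _ = low≢high c p _ (colour-low c 0 q (s≤s z≤n))
colour-proper c (suc zero) q (suc (suc p)) q' _ _ = low≢high c p _ (colour-low c 1 q (s≤s (s≤s z≤n)))
colour-proper c (suc (suc p)) q zero q' _ _ = low≢high c p _ (colour-low c 0 q' (s≤s z≤n)) ∘ sym
colour-proper c (suc (suc p)) q (suc zero) q' _ _ = low≢high c p _ (colour-low c 1 q' (s≤s (s≤s z≤n))) ∘ sym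
-- two parts ≥ 2 with the same colour are the same part, hence not adjacent
colour-proper c (suc (suc p)) q (suc (suc p')) q' _ adj same = contradiction
  (trans (sym adj) (trans (adjacent-high c (suc (suc p)) q p' q')
    (cong not (⌊⌋-yes (suc (suc p) ≟ suc (suc p')) (cong suc (+-cancelˡ-≡ c (suc p) (suc p') same))))))
  λ ()

Gact-colourable : ∀ a c t → 1 ≤ c → Colorable (Gact a c (suc (suc t))) (suc t + c)
Gact-colourable a c t c≥1 = colourOf , proper
  where
  t₂ = suc (suc t)
  colourOf : Fin (t₂ * a) → Fin (suc t + c)
  colourOf x = fromℕ< (colour-bound c t (part a t₂ x) (position a t₂ x) (toℕ<n (proj₁ (remQuot {t₂} a x))))
  proper : ∀ x y → Gact a c t₂ x y ≡ true → colourOf x ≢ colourOf y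
  proper x y adj same = colour-proper c (part a t₂ x) (position a t₂ x) (part a t₂ y) (position a t₂ y) c≥1 adj
    (trans (sym (toℕ-fromℕ< _)) (trans (cong toℕ same) (toℕ-fromℕ< _)))

adjacent-nonspecial : ∀ c p p' q₀ q → c ≤ q₀ → p ≢ p' → adjacent c p q₀ p' q ≡ true
adjacent-nonspecial c p p' q₀ q c≤q₀ p≢p' rewrite ⌊⌋-no (p ≟ p') p≢p' | ⌊⌋-no (q₀ <? c) (≤⇒≯ c≤q₀) =
  cong not (trans (cong (⌊ p <? 2 ⌋ ∧_) (∧-zeroʳ ⌊ p' <? 2 ⌋)) (∧-zeroʳ ⌊ p <? 2 ⌋))

adjacent-special : ∀ c q q' → q < c → q' < c → q ≢ q' → adjacent c 0 q 0 q' ≡ true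
adjacent-special c q q' q<c q'<c q≢q'
  rewrite ⌊⌋-yes (q <? c) q<c | ⌊⌋-yes (q' <? c) q'<c | ⌊⌋-no (q ≟ q') q≢q' = refl

module Clique (a c t : ℕ) (c<a : c < a) where

  -- the position c, which is not special
  posC : Fin a
  posC = fromℕ< c<a

  c≤posC : c ≤ toℕ posC
  c≤posC = ≤-reflexive (sym (toℕ-fromℕ< c<a))

  posU : Fin c → Fin a
  posU j = inject≤ j (<⇒≤ c<a)

  posU<c : ∀ j → toℕ (posU j) < c
  posU<c j = subst (_< c) (sym (toℕ-inject≤ j (<⇒≤ c<a))) (toℕ<n j)

  posU-injective : ∀ {j j'} → toℕ (posU j) ≡ toℕ (posU j') → j ≡ j'
  posU-injective {j} {j'} same =
    toℕ-injective (trans (sym (toℕ-inject≤ j (<⇒≤ c<a))) (trans same (toℕ-inject≤ j' (<⇒≤ c<a))))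

  cliqueVertex : Fin (suc t) ⊎ Fin c → Fin (suc (suc t) * a)
  cliqueVertex (inj₁ p) = combine (fsuc p) posC
  cliqueVertex (inj₂ j) = combine (fzero {suc t}) (posU j)

  cliqueVertex-adjacent : ∀ u w → u ≢ w → Gact a c (suc (suc t)) (cliqueVertex u) (cliqueVertex w) ≡ true
  cliqueVertex-adjacent (inj₁ p) (inj₁ p') p≢p' = trans (Gact-combine a c (suc (suc t)) (fsuc p) (fsuc p') posC posC)
    (adjacent-nonspecial c (suc (toℕ p)) (suc (toℕ p')) (toℕ posC) (toℕ posC) c≤posC (p≢p' ∘ cong inj₁ ∘ toℕ-injective ∘ suc-injective))
  cliqueVertex-adjacent (inj₁ p) (inj₂ j) _ = trans (Gact-combine a c (suc (suc t)) (fsuc p) fzero posC (posU j))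
    (adjacent-nonspecial c (suc (toℕ p)) 0 (toℕ posC) (toℕ (posU j)) c≤posC λ ())
  cliqueVertex-adjacent (inj₂ j) (inj₁ p) _ = trans (Gact-combine a c (suc (suc t)) fzero (fsuc p) (posU j) posC)
    (trans (adjacent-sym c 0 (toℕ (posU j)) (suc (toℕ p)) (toℕ posC))
           (adjacent-nonspecial c (suc (toℕ p)) 0 (toℕ posC) (toℕ (posU j)) c≤posC λ ()))
  cliqueVertex-adjacent (inj₂ j) (inj₂ j') j≢j' = trans (Gact-combine a c (suc (suc t)) fzero fzero (posU j) (posU j'))
    (adjacent-special c (toℕ (posU j)) (toℕ (posU j')) (posU<c j) (posU<c j') (j≢j' ∘ cong inj₂ ∘ posU-injective))

  Gact-colours≥ : ∀ k → Colorable (Gact a c (suc (suc t))) k → suc t + c ≤ k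
  Gact-colours≥ k = clique-bound (Gact a c (suc (suc t))) (cliqueVertex ∘ splitAt (suc t)) distinct⇒adjacent
    where
    distinct⇒adjacent : ∀ x y → x ≢ y → Gact a c (suc (suc t)) (cliqueVertex (splitAt (suc t) x)) (cliqueVertex (splitAt (suc t) y)) ≡ true
    distinct⇒adjacent x y x≢y = cliqueVertex-adjacent (splitAt (suc t) x) (splitAt (suc t) y) λ same →
      x≢y (trans (sym (join-splitAt (suc t) c x)) (trans (cong (join (suc t) c) same) (join-splitAt (suc t) c y)))

open Clique using (Gact-colours≥)

theorem9 : (a c t : ℕ) → 2 ≤ a → 2 ≤ t → 1 ≤ c → c < a →
    (a ∸ 1) * (c ∸ 1) < t ∸ 1 →
    IsExtremal (Gact a c t) (a * (t ∸ 1)) (t + c ∸ 1)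
theorem9 (suc a') (suc c') (suc (suc t)) (s≤s _) (s≤s (s≤s _)) c≥1 c<a small =
  ( Gact-simple a c t₂
  , Gact-regular a c t
  , Gact-colourable a c t c≥1
  , Gact-colours≥ a c t c<a )
  , order-bound a' c' (suc t) small
  where
  a = suc a'
  c = suc c'
  t₂ = suc (suc t)
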